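{- For any games with activeness $G^g,H^h,J^j,K^k$, if $G^g=H^h$ and $J^j=K^k$, then $G^g+J^j=H^h+K^k$.
   Context: Let $\mathcal{B}=\{0,1\}$. Define $\mathbb{I}_0=\{\emptyset\}\times\mathcal{B}$ and $\mathbb{I}_n=2^{\mathbb{I}_{n-1}}\times\mathcal{B}$ for $n\ge1$; a game with activeness is an element of $\mathbb{I}=\bigcup_{n\ge0}\mathbb{I}_n$. A pair $(G,g)$ is written $G^g$; elements of $G$ are its options, $g=1$ meaning active. The outcome $o$ is defined recursively: $o(G^g)=\mathscr{N}$ if $g=1$ and some option has outcome $\mathscr{P}$, and $o(G^g)=\mathscr{P}$ otherwise. The sum is $G^g+H^h=(\{G'^{g'}+H^h:G'^{g'}\in G^g\}\cup\{G^g+H'^{h'}:H'^{h'}\in H^h\})^{\max\{g,h\}}$. $G^g=H^h$ means $o(G^g+X^x)=o(H^h+X^x)$ for all games $X^x$. -}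

module Defs where

open import Data.Bool using (Bool; true; false; _∧_; _∨_; if_then_else_)
open import Data.List using (List; []; _∷_; _++_)
open import Relation.Binary.PropositionalEquality using (_≡_)

-- A game with activeness G^g: a finite set of options (represented by a
-- list; order and multiplicity are irrelevant for everything below) and an
-- activeness bit g (true = active).  Every element of 𝕀 = ⋃ 𝕀_n is a
-- hereditarily finite such object, i.e. exactly a finite tree of this type.
data Game : Set where
  mk : List Game → Bool → Game

data Outcome : Set where
  𝒩 𝒫 : Outcome

isP : Outcome → Bool
isP 𝒩 = false
isP 𝒫 = true

mutual
  o : Game → Outcome
  o (mk os g) = if g ∧ someP os then 𝒩 else 𝒫

  someP : List Game → Bool
  someP [] = false
  someP (x ∷ xs) = isP (o x) ∨ someP xs

mutual
  infixl 6 _⊕_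
  _⊕_ : Game → Game → Game
  G@(mk gs g) ⊕ H@(mk hs h) = mk (leftOpts gs H ++ rightOpts G hs) (g ∨ h)

  leftOpts : List Game → Game → List Game
  leftOpts [] H = []
  leftOpts (G' ∷ gs) H = (G' ⊕ H) ∷ leftOpts gs H

  rightOpts : Game → List Game → List Game
  rightOpts G [] = []
  rightOpts G (H' ∷ hs) = (G ⊕ H') ∷ rightOpts G hs

infix 4 _≈_
_≈_ : Game → Game → Set
G ≈ H = ∀ (X : Game) → o (G ⊕ X) ≡ o (H ⊕ X)

-- The outcome of a game depends only on its activeness and on the multiset of
-- outcomes of its options.  By simultaneous induction, (A + B) + C and
-- A + (B + C), as well as A + (B + C) and B + (A + C), have the same
-- activeness and options that correspond one-to-one with equal outcomes, so
-- they have equal outcomes.  These two rearrangements bring G, and then J,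
-- to the front of (G + J) + X, where the hypotheses replace them by H and K.
module Submission where

open import Defs
open import Algebra.Bundles using (CommutativeMonoid)
open import Data.Bool using (Bool; _∧_; _∨_; if_then_else_)
open import Data.Bool.ListAction using (or)
open import Data.Bool.Properties using (∨-assoc; ∨-isCommutativeMonoid; ∨-commutativeMonoid)
open import Data.List using (List; []; _∷_; _++_; map)
open import Data.List.Properties using (map-++; ++-assoc)
open import Data.List.Relation.Binary.Permutation.Propositional
  using (_↭_; ↭-reflexive; ↭⇒↭ₛ; module PermutationReasoning)
open import Data.List.Relation.Binary.Permutation.Propositional.Properties using (map⁺; shifts)
import Data.List.Relation.Binary.Permutation.Setoid.Properties as PermutationSetoid
open import Relation.Binary.PropositionalEquality
open import Algebra.Properties.CommutativeSemigroup (CommutativeMonoid.commutativeSemigroup ∨-commutativeMonoid)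
  using (x∙yz≈y∙xz)

or-↭ : ∀ {bs cs : List Bool} → bs ↭ cs → or bs ≡ or cs
or-↭ p = PermutationSetoid.foldr-commMonoid (setoid Bool) ∨-isCommutativeMonoid (↭⇒↭ₛ p)

someP≡or-map : ∀ xs → someP xs ≡ or (map isP (map o xs))
someP≡or-map []       = refl
someP≡or-map (x ∷ xs) = cong (isP (o x) ∨_) (someP≡or-map xs)

o-cong : ∀ {xs ys g h} → g ≡ h → map o xs ↭ map o ys → o (mk xs g) ≡ o (mk ys h)
o-cong {xs} {ys} {g} refl p = cong (λ s → if g ∧ s then 𝒩 else 𝒫) (begin
  someP xs                ≡⟨ someP≡or-map xs ⟩
  or (map isP (map o xs)) ≡⟨ or-↭ (map⁺ isP p) ⟩
  or (map isP (map o ys)) ≡⟨ someP≡or-map ys ⟨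
  someP ys                ∎)
  where open ≡-Reasoning

leftOpts-++ : ∀ xs ys C → leftOpts (xs ++ ys) C ≡ leftOpts xs C ++ leftOpts ys C
leftOpts-++ []       ys C = refl
leftOpts-++ (x ∷ xs) ys C = cong (x ⊕ C ∷_) (leftOpts-++ xs ys C)

rightOpts-++ : ∀ A xs ys → rightOpts A (xs ++ ys) ≡ rightOpts A xs ++ rightOpts A ys
rightOpts-++ A []       ys = refl
rightOpts-++ A (x ∷ xs) ys = cong (A ⊕ x ∷_) (rightOpts-++ A xs ys)

map-o-leftOpts-++ : ∀ xs ys C zs →
  map o (leftOpts (xs ++ ys) C ++ zs) ≡ map o (leftOpts xs C) ++ map o (leftOpts ys C) ++ map o zs
map-o-leftOpts-++ xs ys C zs = begin
  map o (leftOpts (xs ++ ys) C ++ zs)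
    ≡⟨ cong (λ l → map o (l ++ zs)) (leftOpts-++ xs ys C) ⟩
  map o ((leftOpts xs C ++ leftOpts ys C) ++ zs)
    ≡⟨ cong (map o) (++-assoc (leftOpts xs C) (leftOpts ys C) zs) ⟩
  map o (leftOpts xs C ++ leftOpts ys C ++ zs)
    ≡⟨ map-++ o (leftOpts xs C) _ ⟩
  map o (leftOpts xs C) ++ map o (leftOpts ys C ++ zs)
    ≡⟨ cong (map o (leftOpts xs C) ++_) (map-++ o (leftOpts ys C) zs) ⟩
  map o (leftOpts xs C) ++ map o (leftOpts ys C) ++ map o zs
    ∎
  where open ≡-Reasoning

map-o-rightOpts-++ : ∀ xs A ys zs →
  map o (xs ++ rightOpts A (ys ++ zs)) ≡ map o xs ++ map o (rightOpts A ys) ++ map o (rightOpts A zs)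
map-o-rightOpts-++ xs A ys zs = begin
  map o (xs ++ rightOpts A (ys ++ zs))
    ≡⟨ map-++ o xs _ ⟩
  map o xs ++ map o (rightOpts A (ys ++ zs))
    ≡⟨ cong (λ l → map o xs ++ map o l) (rightOpts-++ A ys zs) ⟩
  map o xs ++ map o (rightOpts A ys ++ rightOpts A zs)
    ≡⟨ cong (map o xs ++_) (map-++ o (rightOpts A ys) _) ⟩
  map o xs ++ map o (rightOpts A ys) ++ map o (rightOpts A zs)
    ∎
  where open ≡-Reasoning

mutual
  o-⊕-assoc : ∀ A B C → o ((A ⊕ B) ⊕ C) ≡ o (A ⊕ (B ⊕ C))
  o-⊕-assoc A@(mk as a) B@(mk bs b) C@(mk cs c) = o-cong (∨-assoc a b c) (↭-reflexive (begin
    map o (leftOpts (leftOpts as B ++ rightOpts A bs) C ++ rightOpts (A ⊕ B) cs)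
      ≡⟨ map-o-leftOpts-++ (leftOpts as B) (rightOpts A bs) C (rightOpts (A ⊕ B) cs) ⟩
    map o (leftOpts (leftOpts as B) C) ++ map o (leftOpts (rightOpts A bs) C) ++ map o (rightOpts (A ⊕ B) cs)
      ≡⟨ cong₂ _++_ (o-⊕-assoc-left as B C) (cong₂ _++_ (o-⊕-assoc-middle A bs C) (o-⊕-assoc-right A B cs)) ⟩
    map o (leftOpts as (B ⊕ C)) ++ map o (rightOpts A (leftOpts bs C)) ++ map o (rightOpts A (rightOpts B cs))
      ≡⟨ map-o-rightOpts-++ (leftOpts as (B ⊕ C)) A (leftOpts bs C) (rightOpts B cs) ⟨
    map o (leftOpts as (B ⊕ C) ++ rightOpts A (leftOpts bs C ++ rightOpts B cs))
      ∎))
    where open ≡-Reasoning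

  o-⊕-assoc-left : ∀ as B C → map o (leftOpts (leftOpts as B) C) ≡ map o (leftOpts as (B ⊕ C))
  o-⊕-assoc-left []       B C = refl
  o-⊕-assoc-left (x ∷ as) B C = cong₂ _∷_ (o-⊕-assoc x B C) (o-⊕-assoc-left as B C)

  o-⊕-assoc-middle : ∀ A bs C → map o (leftOpts (rightOpts A bs) C) ≡ map o (rightOpts A (leftOpts bs C))
  o-⊕-assoc-middle A []       C = refl
  o-⊕-assoc-middle A (y ∷ bs) C = cong₂ _∷_ (o-⊕-assoc A y C) (o-⊕-assoc-middle A bs C)

  o-⊕-assoc-right : ∀ A B cs → map o (rightOpts (A ⊕ B) cs) ≡ map o (rightOpts A (rightOpts B cs))
  o-⊕-assoc-right A B []       = refl
  o-⊕-assoc-right A B (z ∷ cs) = cong₂ _∷_ (o-⊕-assoc A B z) (o-⊕-assoc-right A B cs)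

mutual
  o-⊕-swap : ∀ A B C → o (A ⊕ (B ⊕ C)) ≡ o (B ⊕ (A ⊕ C))
  o-⊕-swap A@(mk as a) B@(mk bs b) C@(mk cs c) = o-cong (x∙yz≈y∙xz a b c) (begin
    map o (leftOpts as (B ⊕ C) ++ rightOpts A (leftOpts bs C ++ rightOpts B cs))
      ≡⟨ map-o-rightOpts-++ (leftOpts as (B ⊕ C)) A (leftOpts bs C) (rightOpts B cs) ⟩
    map o (leftOpts as (B ⊕ C)) ++ map o (rightOpts A (leftOpts bs C)) ++ map o (rightOpts A (rightOpts B cs))
      ≡⟨ cong₂ _++_ (o-⊕-swap-left as B C) (cong₂ _++_ (o-⊕-swap-middle A bs C) (o-⊕-swap-right A B cs)) ⟩
    map o (rightOpts B (leftOpts as C)) ++ map o (leftOpts bs (A ⊕ C)) ++ map o (rightOpts B (rightOpts A cs))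
      ↭⟨ shifts (map o (rightOpts B (leftOpts as C))) (map o (leftOpts bs (A ⊕ C))) ⟩
    map o (leftOpts bs (A ⊕ C)) ++ map o (rightOpts B (leftOpts as C)) ++ map o (rightOpts B (rightOpts A cs))
      ≡⟨ map-o-rightOpts-++ (leftOpts bs (A ⊕ C)) B (leftOpts as C) (rightOpts A cs) ⟨
    map o (leftOpts bs (A ⊕ C) ++ rightOpts B (leftOpts as C ++ rightOpts A cs))
      ∎)
    where open PermutationReasoning

  o-⊕-swap-left : ∀ as B C → map o (leftOpts as (B ⊕ C)) ≡ map o (rightOpts B (leftOpts as C))
  o-⊕-swap-left []       B C = refl
  o-⊕-swap-left (x ∷ as) B C = cong₂ _∷_ (o-⊕-swap x B C) (o-⊕-swap-left as B C)

  o-⊕-swap-middle : ∀ A bs C → map o (rightOpts A (leftOpts bs C)) ≡ map o (leftOpts bs (A ⊕ C))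
  o-⊕-swap-middle A []       C = refl
  o-⊕-swap-middle A (y ∷ bs) C = cong₂ _∷_ (o-⊕-swap A y C) (o-⊕-swap-middle A bs C)

  o-⊕-swap-right : ∀ A B cs → map o (rightOpts A (rightOpts B cs)) ≡ map o (rightOpts B (rightOpts A cs))
  o-⊕-swap-right A B []       = refl
  o-⊕-swap-right A B (z ∷ cs) = cong₂ _∷_ (o-⊕-swap A B z) (o-⊕-swap-right A B cs)

theorem3p23 : ∀ (G H J K : Game) → G ≈ H → J ≈ K → G ⊕ J ≈ H ⊕ K
theorem3p23 G H J K G≈H J≈K X = begin
  o ((G ⊕ J) ⊕ X) ≡⟨ o-⊕-assoc G J X ⟩
  o (G ⊕ (J ⊕ X)) ≡⟨ G≈H (J ⊕ X) ⟩
  o (H ⊕ (J ⊕ X)) ≡⟨ o-⊕-swap H J X ⟩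
  o (J ⊕ (H ⊕ X)) ≡⟨ J≈K (H ⊕ X) ⟩
  o (K ⊕ (H ⊕ X)) ≡⟨ o-⊕-swap K H X ⟩
  o (H ⊕ (K ⊕ X)) ≡⟨ o-⊕-assoc H K X ⟨
  o ((H ⊕ K) ⊕ X) ∎
  where open ≡-Reasoning
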